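{- Let $k\subseteq K\subseteq L\subseteq\overline{k}$ be fields with $L=K(\alpha,\beta)$, and suppose there exist relatively prime $M,N\in R_T$ with $\alpha^{M}=a\in K$ and $\beta^{N}=b\in K$. Then $L=K(\alpha+\beta)$.
   Context: Let $q$ be a prime power, $k=\mathbb{F}_q(T)$, $R_T=\mathbb{F}_q[T]$, and $\overline{k}$ an algebraic closure of $k$. The Carlitz–Hayes action of $R_T$ on $\overline{k}$ is defined, for $u\in\overline{k}$ and $N\in R_T$, by $u^{N}:=N(\varphi+\mu_T)(u)$, where $\varphi(u)=u^{q}$ and $\mu_T(u)=Tu$. -}

module Defs where

open import Level using (Level; _⊔_; suc)
open import Algebra.Bundles using (CommutativeRing)
open import Data.Nat using (ℕ; zero) renaming (suc to sucℕ; _^_ to _^ℕ_; _≤_ to _≤ℕ_)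
open import Data.Nat.Primality using (Prime)
open import Data.Fin using (Fin)
open import Data.List using (List; []; _∷_; map; _++_; [_])
open import Data.List.Relation.Unary.All using (All)
open import Data.Product using (Σ; ∃; _×_; _,_)
open import Data.Sum using (_⊎_)
open import Relation.Nullary using (¬_)
open import Relation.Unary using (Pred)
open import Relation.Binary.PropositionalEquality using (_≡_)
open import Function.Bundles using (_⇔_)

record Field (c ℓ : Level) : Set (suc (c ⊔ ℓ)) where
  field
    commutativeRing : CommutativeRing c ℓ
  open CommutativeRing commutativeRing public
  field
    1≉0     : ¬ (1# ≈ 0#)
    inverse : ∀ x → ¬ (x ≈ 0#) → ∃ λ y → x * y ≈ 1#

IsPrimePower : ℕ → Set
IsPrimePower q = Σ ℕ λ p → Σ ℕ λ e → Prime p × (1 ≤ℕ e) × (q ≡ p ^ℕ e)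

module FieldDefs {c ℓ : Level} (Ω : Field c ℓ) where
  open Field Ω

  _^_ : Carrier → ℕ → Carrier
  x ^ zero    = 1#
  x ^ sucℕ n  = x * (x ^ n)

  record IsSubfield {ℓp : Level} (P : Pred Carrier ℓp) : Set (c ⊔ ℓ ⊔ ℓp) where
    field
      resp  : ∀ {x y} → x ≈ y → P x → P y
      has0  : P 0#
      has1  : P 1#
      +-cl  : ∀ {x y} → P x → P y → P (x + y)
      neg-cl : ∀ {x} → P x → P (- x)
      *-cl  : ∀ {x y} → P x → P y → P (x * y)
      inv-cl : ∀ {x y} → P x → x * y ≈ 1# → P y

  _⊆_ : ∀ {ℓ₁ ℓ₂} → Pred Carrier ℓ₁ → Pred Carrier ℓ₂ → Set (c ⊔ ℓ₁ ⊔ ℓ₂)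
  P ⊆ Q = ∀ {x} → P x → Q x

  _≐_ : ∀ {ℓ₁ ℓ₂} → Pred Carrier ℓ₁ → Pred Carrier ℓ₂ → Set (c ⊔ ℓ₁ ⊔ ℓ₂)
  P ≐ Q = ∀ x → P x ⇔ Q x

  data Gen {ℓp : Level} (G : Pred Carrier ℓp) : Pred Carrier (c ⊔ ℓ ⊔ ℓp) where
    base : ∀ {x} → G x → Gen G x
    resp : ∀ {x y} → x ≈ y → Gen G x → Gen G y
    zer  : Gen G 0#
    one  : Gen G 1#
    add  : ∀ {x y} → Gen G x → Gen G y → Gen G (x + y)
    neg  : ∀ {x} → Gen G x → Gen G (- x)
    mul  : ∀ {x y} → Gen G x → Gen G y → Gen G (x * y)
    inv  : ∀ {x y} → Gen G x → x * y ≈ 1# → Gen G y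

  Adj₂ : ∀ {ℓp} → Pred Carrier ℓp → Carrier → Carrier → Pred Carrier (c ⊔ ℓ ⊔ ℓp)
  Adj₂ K α β = Gen (λ x → K x ⊎ (x ≈ α ⊎ x ≈ β))

  Adj₁ : ∀ {ℓp} → Pred Carrier ℓp → Carrier → Pred Carrier (c ⊔ ℓ ⊔ ℓp)
  Adj₁ K γ = Gen (λ x → K x ⊎ x ≈ γ)

  -- Polynomials as coefficient lists (constant term first)

  eval : List Carrier → Carrier → Carrier
  eval []       x = 0#
  eval (a ∷ as) x = a + x * eval as x

  _+ₚ_ : List Carrier → List Carrier → List Carrier
  []       +ₚ ys       = ys
  (x ∷ xs) +ₚ []       = x ∷ xs
  (x ∷ xs) +ₚ (y ∷ ys) = (x + y) ∷ (xs +ₚ ys)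

  _*ₚ_ : List Carrier → List Carrier → List Carrier
  []       *ₚ ys = []
  (x ∷ xs) *ₚ ys = map (x *_) ys +ₚ (0# ∷ (xs *ₚ ys))

  _≈ₚ_ : List Carrier → List Carrier → Set (c ⊔ ℓ)
  xs ≈ₚ ys = All (_≈ 0#) (xs +ₚ map -_ ys)

  -- Polynomials over a subfield F (e.g. R_T = F_q[T]), divisibility, coprimality

  Poly : ∀ {ℓp} → Pred Carrier ℓp → List Carrier → Set (c ⊔ ℓp)
  Poly F = All F

  Divides : ∀ {ℓp} → Pred Carrier ℓp → List Carrier → List Carrier → Set (c ⊔ ℓ ⊔ ℓp)
  Divides F D M = ∃ λ Q → Poly F Q × ((D *ₚ Q) ≈ₚ M)

  RelPrime : ∀ {ℓp} → Pred Carrier ℓp → List Carrier → List Carrier → Set (c ⊔ ℓ ⊔ ℓp)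
  RelPrime F M N = ∀ D → Poly F D → Divides F D M → Divides F D N →
                   ∃ λ u → F u × ¬ (u ≈ 0#) × (D ≈ₚ [ u ])

  record IsAlgClosureOfFqT {ℓp : Level} (q : ℕ) (F : Pred Carrier ℓp) (T : Carrier)
         : Set (c ⊔ ℓ ⊔ ℓp) where
    field
      F-subfield   : IsSubfield F
      enum         : Fin q → Carrier
      enum-in      : ∀ i → F (enum i)
      enum-inj     : ∀ i j → enum i ≈ enum j → i ≡ j
      enum-surj    : ∀ x → F x → ∃ λ i → x ≈ enum i
      transcendental : ∀ as → Poly F as → eval as T ≈ 0# → All (_≈ 0#) as
      algClosed    : ∀ a as → ∃ λ x → eval ((a ∷ as) ++ [ 1# ]) x ≈ 0#
      algebraic    : ∀ x → ∃ λ as → Poly (Gen (λ y → F y ⊎ y ≈ T)) as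
                                   × (eval (as ++ [ 1# ]) x ≈ 0#)

  -- Carlitz–Hayes action: u^N = N(φ + μ_T)(u), φ(u) = u^q, μ_T(u) = T u.
  -- Horner: (c₀ + T N')(φ+μ_T)(u) = c₀ u + (φ+μ_T)(N'(φ+μ_T)(u)).

  carlitz : ℕ → Carrier → List Carrier → Carrier → Carrier
  carlitz q T []       u = 0#
  carlitz q T (a ∷ as) u = a * u + ((carlitz q T as u) ^ q + T * carlitz q T as u)

{-# OPTIONS --safe #-}
-- Write γ = α + β. As M and N are coprime in F_q[T], Euclid's algorithm yields A, B and a nonzero
-- constant u with A M + B N = u. The Carlitz action is an action of the ring F_q[T] by additive maps
-- (additivity is the Frobenius identity (x + y)^q = x^q + y^q, F_q-linearity is x^q = x on F_q), so
-- u α = α^(A M + B N) = (α^M)^A + (α^N)^B with α^M = a and α^N = γ^N - β^N = γ^N - b. Hence u α, and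
-- so α, lies in K(γ); then β = γ - α does as well, and K(α, β) = K(γ).
module Submission where

open import Defs
open import Level using (_⊔_)
open import Algebra.Bundles using (CommutativeRing)
open import Data.Nat as ℕ using (ℕ; zero; suc; _<_; _≤_)
import Data.Nat.Properties as ℕ
open import Data.Nat.Divisibility using (_∣_; divides)
open import Data.Nat.Primality using (Prime)
open import Data.Nat.Combinatorics using (_C_; nCn≡1)
import Data.Integer as ℤ
open import Data.Fin as Fin using (Fin; toℕ; inject₁; fromℕ)
import Data.Fin.Properties as Fin
open import Data.Fin.Permutation using (Permutation′; permutation; _⟨$⟩ʳ_)
open import Data.List as List using (List; []; _∷_; [_]; length)
import Data.List.Properties as List
open import Data.List.Relation.Unary.All using (All; []; _∷_)
open import Data.Product using (∃; ∃₂; _,_; proj₁; proj₂) renaming (_×_ to _∧_)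
open import Data.Sum using (_⊎_; inj₁; inj₂)
open import Data.Empty using (⊥-elim)
open import Function using (_∘_)
open import Function.Bundles using (mk⇔)
import Function.Properties.Equivalence as ⇔
open import Relation.Nullary using (¬_; Dec; yes; no)
open import Relation.Unary using (Pred)
open import Relation.Binary.PropositionalEquality as ≡ using (_≡_; _≢_)
import Algebra.Properties.CommutativeMonoid.Sum

module _ where

  open import Data.Nat
  open import Data.Nat.Properties
  open import Data.Nat.Divisibility
  open import Data.Nat.DivMod using (m*[n/m]≡n)
  open import Data.Nat.Primality
  open import Data.Nat.Combinatorics using (k![n∸k]!∣n!)
  open import Data.Nat.Combinatorics.Specification using (nCk≡n!/k![n-k]!)
  open import Relation.Binary.PropositionalEquality

  prime∤factorial : ∀ {p} → Prime p → ∀ n → n < p → ¬ (p ∣ n !)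
  prime∤factorial p-prime zero    _   p∣1  = ¬prime[1] (subst Prime (∣1⇒≡1 p∣1) p-prime)
  prime∤factorial p-prime (suc n) n<p p∣n! with euclidsLemma (suc n) (n !) p-prime p∣n!
  ... | inj₁ p∣1+n = <⇒≱ n<p (∣⇒≤ p∣1+n)
  ... | inj₂ p∣n!  = prime∤factorial p-prime n (<-trans (n<1+n n) n<p) p∣n!

  n∣n! : ∀ n → .{{NonZero n}} → n ∣ n !
  n∣n! (suc n) = m∣m*n (n !)

  prime∣binomial : ∀ {p k} → Prime p → 0 < k → k < p → p ∣ p C k
  prime∣binomial {p} {k} p-prime 0<k k<p
    with euclidsLemma (k ! * (p ∸ k) !) (p C k) p-prime p∣k![p∸k]!pCk
    where
      instance
        k![p∸k]!≢0 : NonZero (k ! * (p ∸ k) !)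
        k![p∸k]!≢0 = k !* (p ∸ k) !≢0
      k![p∸k]!pCk≡p! : k ! * (p ∸ k) ! * (p C k) ≡ p !
      k![p∸k]!pCk≡p! = trans (cong (k ! * (p ∸ k) ! *_) (nCk≡n!/k![n-k]! (<⇒≤ k<p)))
                             (m*[n/m]≡n (k![n∸k]!∣n! (<⇒≤ k<p)))
      p∣k![p∸k]!pCk : p ∣ k ! * (p ∸ k) ! * (p C k)
      p∣k![p∸k]!pCk = subst (p ∣_) (sym k![p∸k]!pCk≡p!) (n∣n! p {{prime⇒nonZero p-prime}})
  ... | inj₂ p∣pCk = p∣pCk
  ... | inj₁ p∣k![p∸k]! with euclidsLemma (k !) ((p ∸ k) !) p-prime p∣k![p∸k]!
  ...   | inj₁ p∣k!     = ⊥-elim (prime∤factorial p-prime k k<p p∣k!)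
  ...   | inj₂ p∣[p∸k]! = ⊥-elim (prime∤factorial p-prime (p ∸ k) (∸-monoʳ-< 0<k (<⇒≤ k<p)) p∣[p∸k]!)

-- With the ring's own elements as coefficients the normaliser cannot see that 1# + - 1# vanishes;
-- integer coefficients make identities with cancellation provable.
module IntegerCoefficientRingSolver {c ℓ} (R : CommutativeRing c ℓ) where

  open ℤ using (ℤ; +_; -[1+_])
  import Data.Integer.Properties as ℤ
  open import Data.Sign as Sign using (Sign)
  open import Data.Maybe as Maybe using (Maybe)
  open import Relation.Nullary.Decidable using (dec⇒maybe)
  open CommutativeRing R
  open import Algebra.Properties.Ring ring using (-0#≈0#; -‿involutive; -‿+-comm; -1*x≈-x)
  open import Algebra.Properties.Semiring.Mult semiring using (_×_; ×-congˡ; ×-homo-+; ×1-homo-*)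
  open import Algebra.Properties.CommutativeSemigroup *-commutativeSemigroup using (interchange)
  open import Algebra.Solver.Ring.AlmostCommutativeRing
  open import Relation.Binary.Reasoning.Setoid setoid

  private
    ⟦_⟧ : ℤ → Carrier
    ⟦ + n      ⟧ = n × 1#
    ⟦ -[1+ n ] ⟧ = - (suc n × 1#)

    ⟦_⟧ˢ : Sign → Carrier
    ⟦ Sign.+ ⟧ˢ = 1#
    ⟦ Sign.- ⟧ˢ = - 1#

    ⟦◃⟧ : ∀ s n → ⟦ s ℤ.◃ n ⟧ ≈ ⟦ s ⟧ˢ * (n × 1#)
    ⟦◃⟧ Sign.+ zero    = sym (zeroʳ _)
    ⟦◃⟧ Sign.- zero    = sym (zeroʳ _)
    ⟦◃⟧ Sign.+ (suc n) = sym (*-identityˡ _)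
    ⟦◃⟧ Sign.- (suc n) = sym (-1*x≈-x _)

    ⟦sign◃abs⟧ : ∀ i → ⟦ i ⟧ ≈ ⟦ ℤ.sign i ⟧ˢ * (ℤ.∣ i ∣ × 1#)
    ⟦sign◃abs⟧ (+ n)      = sym (*-identityˡ _)
    ⟦sign◃abs⟧ -[1+ n ]   = sym (-1*x≈-x _)

    ⟦*⟧ˢ : ∀ s t → ⟦ s Sign.* t ⟧ˢ ≈ ⟦ s ⟧ˢ * ⟦ t ⟧ˢ
    ⟦*⟧ˢ Sign.+ _      = sym (*-identityˡ _)
    ⟦*⟧ˢ Sign.- Sign.+ = sym (*-identityʳ _)
    ⟦*⟧ˢ Sign.- Sign.- = sym (trans (-1*x≈-x _) (-‿involutive _))

    ⟦⊖⟧ : ∀ m n → ⟦ m ℤ.⊖ n ⟧ ≈ m × 1# + - (n × 1#)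
    ⟦⊖⟧ m       zero    = begin
      ⟦ m ℤ.⊖ 0 ⟧    ≡⟨ ≡.cong ⟦_⟧ (ℤ.⊖-≥ {m} ℕ.z≤n) ⟩
      m × 1#         ≈⟨ +-identityʳ _ ⟨
      m × 1# + 0#    ≈⟨ +-congˡ -0#≈0# ⟨
      m × 1# + - 0#  ∎
    ⟦⊖⟧ zero    (suc n) = sym (+-identityˡ _)
    ⟦⊖⟧ (suc m) (suc n) = begin
      ⟦ suc m ℤ.⊖ suc n ⟧                  ≡⟨ ≡.cong ⟦_⟧ (ℤ.[1+m]⊖[1+n]≡m⊖n m n) ⟩
      ⟦ m ℤ.⊖ n ⟧                          ≈⟨ ⟦⊖⟧ m n ⟩
      m × 1# + - (n × 1#)                  ≈⟨ +-congˡ (+-identityˡ _) ⟨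
      m × 1# + (0# + - (n × 1#))           ≈⟨ +-congˡ (+-congʳ (-‿inverseʳ 1#)) ⟨
      m × 1# + ((1# + - 1#) + - (n × 1#))  ≈⟨ +-congˡ (+-assoc _ _ _) ⟩
      m × 1# + (1# + (- 1# + - (n × 1#)))  ≈⟨ +-assoc _ _ _ ⟨
      (m × 1# + 1#) + (- 1# + - (n × 1#))  ≈⟨ +-cong (+-comm _ _) (-‿+-comm _ _) ⟩
      (1# + m × 1#) + - (1# + n × 1#)      ∎

    ⟦+⟧ : ∀ i j → ⟦ i ℤ.+ j ⟧ ≈ ⟦ i ⟧ + ⟦ j ⟧
    ⟦+⟧ (+ m)    (+ n)    = ×-homo-+ 1# m n
    ⟦+⟧ (+ m)    -[1+ n ] = ⟦⊖⟧ m (suc n)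
    ⟦+⟧ -[1+ m ] (+ n)    = trans (⟦⊖⟧ n (suc m)) (+-comm _ _)
    ⟦+⟧ -[1+ m ] -[1+ n ] = trans (-‿cong (trans (×-congˡ (≡.cong suc (≡.sym (ℕ.+-suc m n))))
                                                 (×-homo-+ 1# (suc m) (suc n))))
                                  (sym (-‿+-comm _ _))

    ⟦*⟧ : ∀ i j → ⟦ i ℤ.* j ⟧ ≈ ⟦ i ⟧ * ⟦ j ⟧
    ⟦*⟧ i j = begin
      ⟦ i ℤ.* j ⟧                                  ≈⟨ ⟦◃⟧ (s Sign.* t) (∣i∣ ℕ.* ∣j∣) ⟩
      ⟦ s Sign.* t ⟧ˢ * ((∣i∣ ℕ.* ∣j∣) × 1#)        ≈⟨ *-cong (⟦*⟧ˢ s t) (×1-homo-* ∣i∣ ∣j∣) ⟩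
      (⟦ s ⟧ˢ * ⟦ t ⟧ˢ) * ((∣i∣ × 1#) * (∣j∣ × 1#))  ≈⟨ interchange _ _ _ _ ⟩
      (⟦ s ⟧ˢ * (∣i∣ × 1#)) * (⟦ t ⟧ˢ * (∣j∣ × 1#))  ≈⟨ *-cong (⟦sign◃abs⟧ i) (⟦sign◃abs⟧ j) ⟨
      ⟦ i ⟧ * ⟦ j ⟧                                ∎
      where
        s t : Sign
        s = ℤ.sign i
        t = ℤ.sign j
        ∣i∣ ∣j∣ : ℕ
        ∣i∣ = ℤ.∣ i ∣
        ∣j∣ = ℤ.∣ j ∣

    ⟦-⟧ : ∀ i → ⟦ ℤ.- i ⟧ ≈ - ⟦ i ⟧
    ⟦-⟧ (+ zero)  = sym -0#≈0#
    ⟦-⟧ (+ suc n) = refl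
    ⟦-⟧ -[1+ n ]  = sym (-‿involutive _)

    ℤ-homomorphism : ℤ.+-*-rawRing -Raw-AlmostCommutative⟶ fromCommutativeRing R
    ℤ-homomorphism = record
      { ⟦_⟧ = ⟦_⟧ ; +-homo = ⟦+⟧ ; *-homo = ⟦*⟧ ; -‿homo = ⟦-⟧ ; 0-homo = refl ; 1-homo = +-identityʳ _ }

    ⟦≟⟧ : ∀ i j → Maybe (⟦ i ⟧ ≈ ⟦ j ⟧)
    ⟦≟⟧ i j = Maybe.map (λ { ≡.refl → refl }) (dec⇒maybe (i ℤ.≟ j))

  open import Algebra.Solver.Ring ℤ.+-*-rawRing (fromCommutativeRing R) ℤ-homomorphism ⟦≟⟧ public
    using (solve; _:+_; _:*_; :-_; _:=_; con)

module FieldTheory {c ℓ} (Ω : Field c ℓ) where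

  open Field Ω
  open FieldDefs Ω
  open IntegerCoefficientRingSolver commutativeRing
  open import Algebra.Properties.Ring ring using (-0#≈0#; x∙y⁻¹≈ε⇒x≈y; +-identityˡ-unique; +-inverseˡ-unique)
  open import Algebra.Properties.Semiring.Mult semiring using (_×_; ×-congʳ; ×-congˡ; ×-assoc-*; ×1-homo-*)
  open import Algebra.Properties.CommutativeSemigroup *-commutativeSemigroup using (x∙yz≈y∙xz)
  import Algebra.Properties.CommutativeSemiring.Exp commutativeSemiring as Exp
  import Algebra.Properties.CommutativeSemiring.Binomial commutativeSemiring as Binomial
  module Σ = Algebra.Properties.CommutativeMonoid.Sum +-commutativeMonoid
  module Π = Algebra.Properties.CommutativeMonoid.Sum *-commutativeMonoid
  open import Relation.Binary.Reasoning.Setoid setoid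

  ^≈^ : ∀ x n → x ^ n ≈ x Exp.^ n
  ^≈^ x zero    = refl
  ^≈^ x (suc n) = *-congˡ (^≈^ x n)

  ^-congˡ : ∀ n {x y} → x ≈ y → x ^ n ≈ y ^ n
  ^-congˡ n {x} {y} x≈y = begin
    x ^ n      ≈⟨ ^≈^ x n ⟩
    x Exp.^ n  ≈⟨ Exp.^-congˡ n x≈y ⟩
    y Exp.^ n  ≈⟨ ^≈^ y n ⟨
    y ^ n      ∎

  ^-homo-* : ∀ x m n → x ^ (m ℕ.+ n) ≈ x ^ m * x ^ n
  ^-homo-* x m n = begin
    x ^ (m ℕ.+ n)            ≈⟨ ^≈^ x (m ℕ.+ n) ⟩
    x Exp.^ (m ℕ.+ n)        ≈⟨ Exp.^-homo-* x m n ⟩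
    x Exp.^ m * x Exp.^ n    ≈⟨ *-cong (^≈^ x m) (^≈^ x n) ⟨
    x ^ m * x ^ n            ∎

  ^-distrib-* : ∀ x y n → (x * y) ^ n ≈ x ^ n * y ^ n
  ^-distrib-* x y n = begin
    (x * y) ^ n              ≈⟨ ^≈^ (x * y) n ⟩
    (x * y) Exp.^ n          ≈⟨ Exp.^-distrib-* x y n ⟩
    x Exp.^ n * y Exp.^ n    ≈⟨ *-cong (^≈^ x n) (^≈^ y n) ⟨
    x ^ n * y ^ n            ∎

  ^-assocʳ : ∀ x m n → (x ^ m) ^ n ≈ x ^ (m ℕ.* n)
  ^-assocʳ x m n = begin
    (x ^ m) ^ n              ≈⟨ ^≈^ (x ^ m) n ⟩
    (x ^ m) Exp.^ n          ≈⟨ Exp.^-congˡ n (^≈^ x m) ⟩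
    (x Exp.^ m) Exp.^ n      ≈⟨ Exp.^-assocʳ x m n ⟩
    x Exp.^ (m ℕ.* n)        ≈⟨ ^≈^ x (m ℕ.* n) ⟨
    x ^ (m ℕ.* n)            ∎

  inverse-cancelˡ : ∀ {x w} y → x * w ≈ 1# → w * (x * y) ≈ y
  inverse-cancelˡ {x} {w} y xw≈1 = begin
    w * (x * y)   ≈⟨ solve 3 (λ x w y → w :* (x :* y) := (x :* w) :* y) refl x w y ⟩
    (x * w) * y   ≈⟨ *-congʳ xw≈1 ⟩
    1# * y        ≈⟨ *-identityˡ y ⟩
    y             ∎

  x*y≉0 : ∀ {x y} → ¬ (x ≈ 0#) → ¬ (y ≈ 0#) → ¬ (x * y ≈ 0#)
  x*y≉0 {x} {y} x≉0 y≉0 xy≈0 with inverse x x≉0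
  ... | w , xw≈1 = y≉0 (begin
    y             ≈⟨ inverse-cancelˡ y xw≈1 ⟨
    w * (x * y)   ≈⟨ *-congˡ xy≈0 ⟩
    w * 0#        ≈⟨ zeroʳ w ⟩
    0#            ∎)

  x^n≉0 : ∀ {x} n → ¬ (x ≈ 0#) → ¬ (x ^ n ≈ 0#)
  x^n≉0 zero    x≉0 = 1≉0
  x^n≉0 (suc n) x≉0 = x*y≉0 x≉0 (x^n≉0 n x≉0)

  x*y≈y⇒x≈1 : ∀ {x y} → ¬ (y ≈ 0#) → x * y ≈ y → x ≈ 1#
  x*y≈y⇒x≈1 {x} {y} y≉0 xy≈y with inverse y y≉0
  ... | v , yv≈1 = begin
    x              ≈⟨ *-identityʳ x ⟨
    x * 1#         ≈⟨ *-congˡ yv≈1 ⟨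
    x * (y * v)    ≈⟨ *-assoc x y v ⟨
    (x * y) * v    ≈⟨ *-congʳ xy≈y ⟩
    y * v          ≈⟨ yv≈1 ⟩
    1#             ∎

  ∏-≉0 : ∀ {n} (f : Fin n → Carrier) → (∀ i → ¬ (f i ≈ 0#)) → ¬ (Π.sum f ≈ 0#)
  ∏-≉0 {zero}  f f≉0 = 1≉0
  ∏-≉0 {suc n} f f≉0 = x*y≉0 (f≉0 Fin.zero) (∏-≉0 (f ∘ Fin.suc) (f≉0 ∘ Fin.suc))

  ∏-const : ∀ {n} (f : Fin n → Carrier) {x} → (∀ i → f i ≈ x) → Π.sum f ≈ x ^ n
  ∏-const {zero}  f f≈x = refl
  ∏-const {suc n} f f≈x = *-cong (f≈x Fin.zero) (∏-const (f ∘ Fin.suc) (f≈x ∘ Fin.suc))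

  x*∏-const-but-one : ∀ {n} (f : Fin n → Carrier) {x} (j : Fin n) →
                      f j ≈ 1# → (∀ i → i ≢ j → f i ≈ x) → x * Π.sum f ≈ x ^ n
  x*∏-const-but-one {suc n} f {x} Fin.zero    fj≈1 f≈x = *-congˡ (begin
    f Fin.zero * Π.sum (f ∘ Fin.suc)  ≈⟨ *-cong fj≈1 (∏-const (f ∘ Fin.suc) (λ i → f≈x (Fin.suc i) (λ ()))) ⟩
    1# * x ^ n                         ≈⟨ *-identityˡ _ ⟩
    x ^ n                              ∎)
  x*∏-const-but-one {suc n} f {x} (Fin.suc j) fj≈1 f≈x = begin
    x * (f Fin.zero * Π.sum (f ∘ Fin.suc))  ≈⟨ x∙yz≈y∙xz x _ _ ⟩
    f Fin.zero * (x * Π.sum (f ∘ Fin.suc))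
      ≈⟨ *-cong (f≈x Fin.zero (λ ())) (x*∏-const-but-one (f ∘ Fin.suc) j fj≈1 f∘suc≈x) ⟩
    x * x ^ n                               ∎
    where
      f∘suc≈x : ∀ i → i ≢ j → f (Fin.suc i) ≈ x
      f∘suc≈x i i≢j = f≈x (Fin.suc i) (i≢j ∘ Fin.suc-injective)

  module _ (f : Carrier → Carrier) (f-cong : ∀ {x y} → x ≈ y → f x ≈ f y)
           (f-+ : ∀ x y → f (x + y) ≈ f x + f y) where

    additive⇒0 : f 0# ≈ 0#
    additive⇒0 = +-identityˡ-unique (f 0#) (f 0#) (begin
      f 0# + f 0#   ≈⟨ f-+ 0# 0# ⟨
      f (0# + 0#)   ≈⟨ f-cong (+-identityˡ 0#) ⟩
      f 0#          ∎)

    additive⇒neg : ∀ x → f (- x) ≈ - f x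
    additive⇒neg x = +-inverseˡ-unique (f (- x)) (f x) (begin
      f (- x) + f x   ≈⟨ f-+ (- x) x ⟨
      f (- x + x)     ≈⟨ f-cong (-‿inverseˡ x) ⟩
      f 0#            ≈⟨ additive⇒0 ⟩
      0#              ∎)

  eval-+ₚ : ∀ P Q x → eval (P +ₚ Q) x ≈ eval P x + eval Q x
  eval-+ₚ []      Q       x = sym (+-identityˡ _)
  eval-+ₚ (a ∷ P) []      x = sym (+-identityʳ _)
  eval-+ₚ (a ∷ P) (b ∷ Q) x = trans (+-congˡ (*-congˡ (eval-+ₚ P Q x)))
    (solve 5 (λ a b x p q → (a :+ b) :+ x :* (p :+ q) := (a :+ x :* p) :+ (b :+ x :* q)) refl a b x (eval P x) (eval Q x))

  eval-map-neg : ∀ P x → eval (List.map -_ P) x ≈ - eval P x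
  eval-map-neg []      x = sym -0#≈0#
  eval-map-neg (a ∷ P) x = trans (+-congˡ (*-congˡ (eval-map-neg P x)))
    (solve 3 (λ a x p → :- a :+ x :* (:- p) := :- (a :+ x :* p)) refl a x (eval P x))

  eval-map-scale : ∀ s P x → eval (List.map (s *_) P) x ≈ s * eval P x
  eval-map-scale s []      x = sym (zeroʳ s)
  eval-map-scale s (a ∷ P) x = trans (+-congˡ (*-congˡ (eval-map-scale s P x)))
    (solve 4 (λ s a x p → s :* a :+ x :* (s :* p) := s :* (a :+ x :* p)) refl s a x (eval P x))

  eval-*ₚ : ∀ P Q x → eval (P *ₚ Q) x ≈ eval P x * eval Q x
  eval-*ₚ []      Q x = sym (zeroˡ _)
  eval-*ₚ (a ∷ P) Q x = begin
    eval (List.map (a *_) Q +ₚ (0# ∷ (P *ₚ Q))) x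
      ≈⟨ eval-+ₚ (List.map (a *_) Q) (0# ∷ (P *ₚ Q)) x ⟩
    eval (List.map (a *_) Q) x + (0# + x * eval (P *ₚ Q) x)
      ≈⟨ +-cong (eval-map-scale a Q x) (+-congˡ (*-congˡ (eval-*ₚ P Q x))) ⟩
    a * eval Q x + (0# + x * (eval P x * eval Q x))
      ≈⟨ solve 4 (λ a q x p → a :* q :+ (con (ℤ.+ 0) :+ x :* (p :* q)) := (a :+ x :* p) :* q)
                 refl a (eval Q x) x (eval P x) ⟩
    (a + x * eval P x) * eval Q x
      ∎

  eval-shift : ∀ k Q x → eval (List.replicate k 0# List.++ Q) x ≈ x ^ k * eval Q x
  eval-shift zero    Q x = sym (*-identityˡ _)
  eval-shift (suc k) Q x = trans (+-identityˡ _) (trans (*-congˡ (eval-shift k Q x)) (sym (*-assoc _ _ _)))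

  eval-[_] : ∀ a x → eval [ a ] x ≈ a
  eval-[ a ] x = trans (+-congˡ (zeroʳ x)) (+-identityʳ a)

  eval-zeros : ∀ P x → All (_≈ 0#) P → eval P x ≈ 0#
  eval-zeros []      x []           = refl
  eval-zeros (a ∷ P) x (a≈0 ∷ P≈0) = trans (+-cong a≈0 (trans (*-congˡ (eval-zeros P x P≈0)) (zeroʳ x))) (+-identityʳ _)

  eval-≈ₚ : ∀ P Q x → P ≈ₚ Q → eval P x ≈ eval Q x
  eval-≈ₚ P Q x P-Q≈0 = x∙y⁻¹≈ε⇒x≈y _ _ (begin
    eval P x + - eval Q x              ≈⟨ +-congˡ (eval-map-neg Q x) ⟨
    eval P x + eval (List.map -_ Q) x  ≈⟨ eval-+ₚ P (List.map -_ Q) x ⟨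
    eval (P +ₚ List.map -_ Q) x        ≈⟨ eval-zeros _ x P-Q≈0 ⟩
    0#                                 ∎)

  module PolynomialsOver {ℓp} {F : Pred Carrier ℓp} (F-subfield : IsSubfield F) where

    open IsSubfield F-subfield

    Poly-+ₚ : ∀ {P Q} → Poly F P → Poly F Q → Poly F (P +ₚ Q)
    Poly-+ₚ []          FQ          = FQ
    Poly-+ₚ (Fa ∷ FP)   []          = Fa ∷ FP
    Poly-+ₚ (Fa ∷ FP)   (Fb ∷ FQ)   = +-cl Fa Fb ∷ Poly-+ₚ FP FQ

    Poly-map-neg : ∀ {P} → Poly F P → Poly F (List.map -_ P)
    Poly-map-neg []        = []
    Poly-map-neg (Fa ∷ FP) = neg-cl Fa ∷ Poly-map-neg FP

    Poly-map-scale : ∀ {s P} → F s → Poly F P → Poly F (List.map (s *_) P)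
    Poly-map-scale Fs []        = []
    Poly-map-scale Fs (Fa ∷ FP) = *-cl Fs Fa ∷ Poly-map-scale Fs FP

    Poly-*ₚ : ∀ {P Q} → Poly F P → Poly F Q → Poly F (P *ₚ Q)
    Poly-*ₚ []        FQ = []
    Poly-*ₚ (Fa ∷ FP) FQ = Poly-+ₚ (Poly-map-scale Fa FQ) (has0 ∷ Poly-*ₚ FP FQ)

    Poly-shift : ∀ k {Q} → Poly F Q → Poly F (List.replicate k 0# List.++ Q)
    Poly-shift zero    FQ = FQ
    Poly-shift (suc k) FQ = has0 ∷ Poly-shift k FQ

  Gen-isSubfield : ∀ {ℓg} {G : Pred Carrier ℓg} → IsSubfield (Gen G)
  Gen-isSubfield = record
    { resp = resp ; has0 = zer ; has1 = one ; +-cl = add ; neg-cl = neg ; *-cl = mul ; inv-cl = inv }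

  Gen-least : ∀ {ℓg ℓs} {G : Pred Carrier ℓg} {S : Pred Carrier ℓs} →
              IsSubfield S → G ⊆ S → Gen G ⊆ S
  Gen-least {G = G} {S} S-subfield G⊆S = least
    where
      module S = IsSubfield S-subfield
      least : Gen G ⊆ S
      least (base g)       = G⊆S g
      least (resp x≈y g)   = S.resp x≈y (least g)
      least zer            = S.has0
      least one            = S.has1
      least (add g h)      = S.+-cl (least g) (least h)
      least (neg g)        = S.neg-cl (least g)
      least (mul g h)      = S.*-cl (least g) (least h)
      least (inv g xy≈1)   = S.inv-cl (least g) xy≈1

  ^-closed : ∀ {ℓs} {S : Pred Carrier ℓs} → IsSubfield S → ∀ {x} n → S x → S (x ^ n)
  ^-closed S-subfield zero    Sx = IsSubfield.has1 S-subfield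
  ^-closed S-subfield (suc n) Sx = IsSubfield.*-cl S-subfield Sx (^-closed S-subfield n Sx)

  Adj₂≐Adj₁ : ∀ {ℓk} {K : Pred Carrier ℓk} {α β γ} →
              Adj₁ K γ α → Adj₁ K γ β → Adj₂ K α β γ → Adj₂ K α β ≐ Adj₁ K γ
  Adj₂≐Adj₁ {K = K} {α} {β} {γ} α∈K⟨γ⟩ β∈K⟨γ⟩ γ∈K⟨α,β⟩ x =
    mk⇔ (Gen-least Gen-isSubfield K,α,β⊆K⟨γ⟩) (Gen-least Gen-isSubfield K,γ⊆K⟨α,β⟩)
    where
      K,α,β⊆K⟨γ⟩ : (λ y → K y ⊎ (y ≈ α ⊎ y ≈ β)) ⊆ Adj₁ K γ
      K,α,β⊆K⟨γ⟩ (inj₁ Ky)          = base (inj₁ Ky)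
      K,α,β⊆K⟨γ⟩ (inj₂ (inj₁ y≈α))  = resp (sym y≈α) α∈K⟨γ⟩
      K,α,β⊆K⟨γ⟩ (inj₂ (inj₂ y≈β))  = resp (sym y≈β) β∈K⟨γ⟩
      K,γ⊆K⟨α,β⟩ : (λ y → K y ⊎ y ≈ γ) ⊆ Adj₂ K α β
      K,γ⊆K⟨α,β⟩ (inj₁ Ky)   = base (inj₁ Ky)
      K,γ⊆K⟨α,β⟩ (inj₂ y≈γ)  = resp (sym y≈γ) γ∈K⟨α,β⟩

  -- Characteristic and the Frobenius map

  ×1-homo-^ : ∀ n e → (n ℕ.^ e) × 1# ≈ (n × 1#) ^ e
  ×1-homo-^ n zero    = +-identityʳ 1#
  ×1-homo-^ n (suc e) = trans (×1-homo-* n (n ℕ.^ e)) (*-congˡ (×1-homo-^ n e))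

  ×-vanishes-on-multiples : ∀ {p n} → p × 1# ≈ 0# → p ∣ n → ∀ z → n × z ≈ 0#
  ×-vanishes-on-multiples {p} p×1≈0 (divides d ≡.refl) z = begin
    (d ℕ.* p) × z              ≈⟨ ×-congʳ (d ℕ.* p) (*-identityˡ z) ⟨
    (d ℕ.* p) × (1# * z)       ≈⟨ ×-assoc-* (d ℕ.* p) 1# z ⟨
    ((d ℕ.* p) × 1#) * z       ≈⟨ *-congʳ (×1-homo-* d p) ⟩
    ((d × 1#) * (p × 1#)) * z  ≈⟨ *-congʳ (*-congˡ p×1≈0) ⟩
    ((d × 1#) * 0#) * z        ≈⟨ solve 2 (λ a z → (a :* con (ℤ.+ 0)) :* z := con (ℤ.+ 0)) refl (d × 1#) z ⟩
    0#                         ∎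

  frobenius : ∀ {p} → Prime p → p × 1# ≈ 0# → ∀ x y → (x + y) ^ p ≈ x ^ p + y ^ p
  -- Prime 0 and Prime 1 are empty, so p ≥ 2 is the only case.
  frobenius {p@(suc (suc m))} p-prime p×1≈0 x y = begin
    (x + y) ^ p                                                         ≈⟨ ^≈^ (x + y) p ⟩
    (x + y) Exp.^ p                                                     ≈⟨ Binomial.theorem p x y ⟩
    term Fin.zero + Σ.sum (term ∘ Fin.suc)                              ≈⟨ +-congˡ (Σ.sum-init-last (term ∘ Fin.suc)) ⟩
    term Fin.zero + (Σ.sum (term ∘ Fin.suc ∘ inject₁) + term (fromℕ p))
      ≈⟨ +-cong first (+-cong (trans (Σ.sum-cong-≋ middle) (Σ.sum-replicate-zero (suc m))) last) ⟩
    y ^ p + (0# + x ^ p)                                                ≈⟨ +-comm _ _ ⟩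
    (0# + x ^ p) + y ^ p                                                ≈⟨ +-congʳ (+-identityˡ _) ⟩
    x ^ p + y ^ p                                                       ∎
    where
      term : Fin (suc p) → Carrier
      term = Binomial.binomialTerm x y p
      first : term Fin.zero ≈ y ^ p
      first = trans (+-identityʳ _) (trans (*-identityˡ _) (sym (^≈^ y p)))
      middle : ∀ i → term (Fin.suc (inject₁ i)) ≈ 0#
      middle i = ×-vanishes-on-multiples p×1≈0 (prime∣binomial p-prime (ℕ.s≤s ℕ.z≤n) k<p) _
        where
          k<p : suc (toℕ (inject₁ i)) ℕ.< p
          k<p = ℕ.s≤s (≡.subst (ℕ._< suc m) (≡.sym (Fin.toℕ-inject₁ i)) (Fin.toℕ<n i))
      last : term (fromℕ p) ≈ x ^ p
      last = top-term (toℕ (fromℕ p)) (Fin.toℕ-fromℕ p)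
        where
          top-term : ∀ j → j ≡ p → (p C j) × (x Exp.^ j * y Exp.^ (p ℕ.∸ j)) ≈ x ^ p
          top-term _ ≡.refl = begin
            (p C p) × (x Exp.^ p * y Exp.^ (p ℕ.∸ p))   ≈⟨ ×-congˡ (nCn≡1 p) ⟩
            x Exp.^ p * y Exp.^ (p ℕ.∸ p) + 0#        ≈⟨ +-identityʳ _ ⟩
            x Exp.^ p * y Exp.^ (p ℕ.∸ p)             ≈⟨ *-congˡ (Exp.^-congʳ y (ℕ.n∸n≡0 p)) ⟩
            x Exp.^ p * 1#                            ≈⟨ *-identityʳ _ ⟩
            x Exp.^ p                                 ≈⟨ ^≈^ x p ⟨
            x ^ p                                     ∎

  frobenius-^ : ∀ {p} → Prime p → p × 1# ≈ 0# →
                ∀ e x y → (x + y) ^ (p ℕ.^ e) ≈ x ^ (p ℕ.^ e) + y ^ (p ℕ.^ e)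
  frobenius-^ p-prime p×1≈0 zero    x y = trans (*-identityʳ _) (sym (+-cong (*-identityʳ _) (*-identityʳ _)))
  frobenius-^ {p} p-prime p×1≈0 (suc e) x y = begin
    (x + y) ^ (p ℕ.* p ℕ.^ e)               ≈⟨ ^-assocʳ (x + y) p (p ℕ.^ e) ⟨
    ((x + y) ^ p) ^ (p ℕ.^ e)               ≈⟨ ^-congˡ (p ℕ.^ e) (frobenius p-prime p×1≈0 x y) ⟩
    (x ^ p + y ^ p) ^ (p ℕ.^ e)             ≈⟨ frobenius-^ p-prime p×1≈0 e (x ^ p) (y ^ p) ⟩
    (x ^ p) ^ (p ℕ.^ e) + (y ^ p) ^ (p ℕ.^ e) ≈⟨ +-cong (^-assocʳ x p (p ℕ.^ e)) (^-assocʳ y p (p ℕ.^ e)) ⟩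
    x ^ (p ℕ.* p ℕ.^ e) + y ^ (p ℕ.* p ℕ.^ e) ∎

  module FiniteSubfield {ℓp} {F : Pred Carrier ℓp} (F-subfield : IsSubfield F)
    {q : ℕ} (enum : Fin q → Carrier) (enum-in : ∀ i → F (enum i))
    (enum-inj : ∀ i j → enum i ≈ enum j → i ≡ j) (enum-surj : ∀ x → F x → ∃ λ i → x ≈ enum i)
    where

    open IsSubfield F-subfield

    index : ∀ {x} → F x → Fin q
    index {x} Fx = proj₁ (enum-surj x Fx)

    enum-index : ∀ {x} (Fx : F x) → enum (index Fx) ≈ x
    enum-index {x} Fx = sym (proj₂ (enum-surj x Fx))

    index₀ : Fin q
    index₀ = index has0

    enum≈0⇒≡index₀ : ∀ i → enum i ≈ 0# → i ≡ index₀
    enum≈0⇒≡index₀ i enumi≈0 = enum-inj i index₀ (trans enumi≈0 (sym (enum-index has0)))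

    ≈0? : ∀ {x} → F x → Dec (x ≈ 0#)
    ≈0? Fx with index Fx Fin.≟ index₀
    ... | yes i≡i₀ = yes (trans (sym (enum-index Fx)) (trans (reflexive (≡.cong enum i≡i₀)) (enum-index has0)))
    ... | no  i≢i₀ = no (λ x≈0 → i≢i₀ (enum≈0⇒≡index₀ _ (trans (enum-index Fx) x≈0)))

    module Relabelling (f f⁻¹ : Carrier → Carrier)
                       (f-cong : ∀ {x y} → x ≈ y → f x ≈ f y) (f⁻¹-cong : ∀ {x y} → x ≈ y → f⁻¹ x ≈ f⁻¹ y)
                       (f-closed : ∀ {x} → F x → F (f x)) (f⁻¹-closed : ∀ {x} → F x → F (f⁻¹ x))
                       (f∘f⁻¹ : ∀ x → f (f⁻¹ x) ≈ x) (f⁻¹∘f : ∀ x → f⁻¹ (f x) ≈ x) where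
      private
        σ τ : Fin q → Fin q
        σ i = index (f-closed (enum-in i))
        τ i = index (f⁻¹-closed (enum-in i))

      π : Permutation′ q
      π = permutation σ τ
        (λ i → enum-inj _ _ (trans (enum-index _) (trans (f-cong (enum-index _)) (f∘f⁻¹ (enum i)))))
        (λ i → enum-inj _ _ (trans (enum-index _) (trans (f⁻¹-cong (enum-index _)) (f⁻¹∘f (enum i)))))

      enum-π : ∀ i → enum (π ⟨$⟩ʳ i) ≈ f (enum i)
      enum-π i = enum-index _

    -- Translation by 1 permutes F, so Σ F = Σ F + q · 1.
    q×1≈0 : q × 1# ≈ 0#
    q×1≈0 = +-identityˡ-unique (q × 1#) (Σ.sum enum) (begin
      q × 1# + Σ.sum enum                  ≈⟨ +-comm _ _ ⟩
      Σ.sum enum + q × 1#                  ≈⟨ +-congˡ (Σ.sum-replicate q) ⟨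
      Σ.sum enum + Σ.sum {q} (λ _ → 1#)    ≈⟨ Σ.∑-distrib-+ {q} enum (λ _ → 1#) ⟨
      Σ.sum {q} (λ i → enum i + 1#)        ≈⟨ Σ.sum-cong-≋ enum-π ⟨
      Σ.sum {q} (λ i → enum (π ⟨$⟩ʳ i))    ≈⟨ Σ.sum-permute enum π ⟨
      Σ.sum enum                           ∎)
      where
        open Relabelling (_+ 1#) (_+ - 1#) +-congʳ +-congʳ (λ Fx → +-cl Fx has1) (λ Fx → +-cl Fx (neg-cl has1))
                         (λ x → solve 2 (λ x o → (x :+ :- o) :+ o := x) refl x 1#)
                         (λ x → solve 2 (λ x o → (x :+ o) :+ :- o := x) refl x 1#)

    private
      punctured : (Fin q → Carrier) → Fin q → Carrier
      punctured f i with i Fin.≟ index₀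
      ... | yes _ = 1#
      ... | no  _ = f i

      punctured-at : ∀ f → punctured f index₀ ≈ 1#
      punctured-at f with index₀ Fin.≟ index₀
      ... | yes _       = refl
      ... | no  i₀≢i₀   = ⊥-elim (i₀≢i₀ ≡.refl)

      punctured-off : ∀ f {i} → i ≢ index₀ → punctured f i ≈ f i
      punctured-off f {i} i≢i₀ with i Fin.≟ index₀
      ... | yes i≡i₀ = ⊥-elim (i≢i₀ i≡i₀)
      ... | no  _    = refl

    0^q≈0 : 0# ^ q ≈ 0#
    0^q≈0 = 0^n≈0 index₀
      where
        0^n≈0 : ∀ {n} → Fin n → 0# ^ n ≈ 0#
        0^n≈0 {suc n} _ = zeroˡ _

    -- Multiplication by x ≉ 0 permutes F and fixes 0; comparing the products of the nonzero
    -- elements (the entry at index₀ replaced by 1) gives x^(q-1) = 1.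
    x^q≈x : ∀ {x} → F x → x ^ q ≈ x
    x^q≈x {x} Fx with ≈0? Fx
    ... | yes x≈0 = begin
      x ^ q    ≈⟨ ^-congˡ q x≈0 ⟩
      0# ^ q   ≈⟨ 0^q≈0 ⟩
      0#       ≈⟨ x≈0 ⟨
      x        ∎
    ... | no x≉0 = begin
      x ^ q         ≈⟨ x*∏-const-but-one h index₀ (punctured-at _) (λ i → punctured-off _) ⟨
      x * Π.sum h   ≈⟨ *-congˡ ∏h≈1 ⟩
      x * 1#        ≈⟨ *-identityʳ x ⟩
      x             ∎
      where
        w : Carrier
        w = proj₁ (inverse x x≉0)
        xw≈1 : x * w ≈ 1#
        xw≈1 = proj₂ (inverse x x≉0)
        open Relabelling (x *_) (w *_) *-congˡ *-congˡ (*-cl Fx) (*-cl (inv-cl Fx xw≈1))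
                         (λ y → trans (sym (*-assoc _ _ _)) (trans (*-congʳ xw≈1) (*-identityˡ y)))
                         (λ y → inverse-cancelˡ y xw≈1)
        g h : Fin q → Carrier
        g = punctured enum
        h = punctured (λ _ → x)
        g≉0 : ∀ i → ¬ (g i ≈ 0#)
        g≉0 i with i Fin.≟ index₀
        ... | yes _    = 1≉0
        ... | no i≢i₀  = i≢i₀ ∘ enum≈0⇒≡index₀ i
        g∘π≈h*g : ∀ i → g (π ⟨$⟩ʳ i) ≈ h i * g i
        g∘π≈h*g i = by-cases (i Fin.≟ index₀)
          where
            by-cases : Dec (i ≡ index₀) → g (π ⟨$⟩ʳ i) ≈ h i * g i
            by-cases (yes i≡i₀) = ≡.subst (λ j → g (π ⟨$⟩ʳ j) ≈ h j * g j) (≡.sym i≡i₀) (begin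
              g (π ⟨$⟩ʳ index₀)   ≡⟨ ≡.cong g π-fixes-index₀ ⟩
              g index₀            ≈⟨ punctured-at enum ⟩
              1#                  ≈⟨ *-identityˡ 1# ⟨
              1# * 1#             ≈⟨ *-cong (punctured-at (λ _ → x)) (punctured-at enum) ⟨
              h index₀ * g index₀ ∎)
              where
                π-fixes-index₀ : π ⟨$⟩ʳ index₀ ≡ index₀
                π-fixes-index₀ = enum≈0⇒≡index₀ _
                  (trans (enum-π index₀) (trans (*-congˡ (enum-index has0)) (zeroʳ x)))
            by-cases (no i≢i₀) = begin
              g (π ⟨$⟩ʳ i)        ≈⟨ punctured-off enum πi≢i₀ ⟩
              enum (π ⟨$⟩ʳ i)     ≈⟨ enum-π i ⟩
              x * enum i          ≈⟨ *-cong (punctured-off (λ _ → x) i≢i₀) (punctured-off enum i≢i₀) ⟨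
              h i * g i           ∎
              where
                πi≢i₀ : π ⟨$⟩ʳ i ≢ index₀
                πi≢i₀ πi≡i₀ = x*y≉0 x≉0 (i≢i₀ ∘ enum≈0⇒≡index₀ i)
                  (trans (sym (enum-π i)) (trans (reflexive (≡.cong enum πi≡i₀)) (enum-index has0)))
        ∏h≈1 : Π.sum h ≈ 1#
        ∏h≈1 = x*y≈y⇒x≈1 (∏-≉0 g g≉0) (begin
          Π.sum h * Π.sum g               ≈⟨ Π.∑-distrib-+ h g ⟨
          Π.sum {q} (λ i → h i * g i)     ≈⟨ Π.sum-cong-≋ g∘π≈h*g ⟨
          Π.sum {q} (λ i → g (π ⟨$⟩ʳ i))  ≈⟨ Π.sum-permute g π ⟨
          Π.sum g                         ∎)

    n×1∈F : ∀ n → F (n × 1#)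
    n×1∈F zero    = has0
    n×1∈F (suc n) = +-cl has1 (n×1∈F n)

    x+y^q≈x^q+y^q : IsPrimePower q → ∀ x y → (x + y) ^ q ≈ x ^ q + y ^ q
    x+y^q≈x^q+y^q (p , e , p-prime , _ , q≡p^e) =
      ≡.subst (λ n → ∀ x y → (x + y) ^ n ≈ x ^ n + y ^ n) (≡.sym q≡p^e) (frobenius-^ p-prime p×1≈0 e)
      where
        p×1≈0 : p × 1# ≈ 0#
        p×1≈0 with ≈0? (n×1∈F p)
        ... | yes p×1≈0 = p×1≈0
        ... | no  p×1≉0 = ⊥-elim (x^n≉0 e p×1≉0 (begin
          (p × 1#) ^ e       ≈⟨ ×1-homo-^ p e ⟨
          (p ℕ.^ e) × 1#     ≡⟨ ≡.cong (_× 1#) q≡p^e ⟨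
          q × 1#             ≈⟨ q×1≈0 ⟩
          0#                 ∎))

  module CarlitzAction {ℓp} (q : ℕ) {F : Pred Carrier ℓp} (F-subfield : IsSubfield F) (T : Carrier)
    (x+y^q≈x^q+y^q : ∀ x y → (x + y) ^ q ≈ x ^ q + y ^ q)
    (x^q≈x : ∀ {x} → F x → x ^ q ≈ x)
    where

    open IsSubfield F-subfield

    φ : Carrier → Carrier
    φ x = x ^ q + T * x

    ρ : List Carrier → Carrier → Carrier
    ρ = carlitz q T

    φ-cong : ∀ {x y} → x ≈ y → φ x ≈ φ y
    φ-cong x≈y = +-cong (^-congˡ q x≈y) (*-congˡ x≈y)

    φ-+ : ∀ x y → φ (x + y) ≈ φ x + φ y
    φ-+ x y = trans (+-cong (x+y^q≈x^q+y^q x y) (distribˡ T x y))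
      (solve 4 (λ a b c d → (a :+ b) :+ (c :+ d) := (a :+ c) :+ (b :+ d)) refl (x ^ q) (y ^ q) (T * x) (T * y))

    φ-0 : φ 0# ≈ 0#
    φ-0 = additive⇒0 φ φ-cong φ-+

    φ-neg : ∀ x → φ (- x) ≈ - φ x
    φ-neg = additive⇒neg φ φ-cong φ-+

    φ-scale : ∀ {s} x → F s → φ (s * x) ≈ s * φ x
    φ-scale {s} x Fs = begin
      (s * x) ^ q + T * (s * x)      ≈⟨ +-congʳ (^-distrib-* s x q) ⟩
      s ^ q * x ^ q + T * (s * x)    ≈⟨ +-congʳ (*-congʳ (x^q≈x Fs)) ⟩
      s * x ^ q + T * (s * x)        ≈⟨ +-congˡ (x∙yz≈y∙xz T s x) ⟩
      s * x ^ q + s * (T * x)        ≈⟨ distribˡ s (x ^ q) (T * x) ⟨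
      s * (x ^ q + T * x)            ∎

    ρ-congʳ : ∀ P {u v} → u ≈ v → ρ P u ≈ ρ P v
    ρ-congʳ []      u≈v = refl
    ρ-congʳ (a ∷ P) u≈v = +-cong (*-congˡ u≈v) (φ-cong (ρ-congʳ P u≈v))

    ρ-+ʳ : ∀ P u v → ρ P (u + v) ≈ ρ P u + ρ P v
    ρ-+ʳ []      u v = sym (+-identityʳ 0#)
    ρ-+ʳ (a ∷ P) u v = trans (+-cong (distribˡ a u v) (trans (φ-cong (ρ-+ʳ P u v)) (φ-+ _ _)))
      (solve 4 (λ a b c d → (a :+ b) :+ (c :+ d) := (a :+ c) :+ (b :+ d)) refl (a * u) (a * v) _ _)

    ρ-negʳ : ∀ P u → ρ P (- u) ≈ - ρ P u
    ρ-negʳ P = additive⇒neg (ρ P) (ρ-congʳ P) (ρ-+ʳ P)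

    ρ-+ₚ : ∀ P Q u → ρ (P +ₚ Q) u ≈ ρ P u + ρ Q u
    ρ-+ₚ []      Q       u = sym (+-identityˡ _)
    ρ-+ₚ (a ∷ P) []      u = sym (+-identityʳ _)
    ρ-+ₚ (a ∷ P) (b ∷ Q) u = trans (+-cong (distribʳ u a b) (trans (φ-cong (ρ-+ₚ P Q u)) (φ-+ _ _)))
      (solve 4 (λ a b c d → (a :+ b) :+ (c :+ d) := (a :+ c) :+ (b :+ d)) refl (a * u) (b * u) _ _)

    ρ-map-neg : ∀ P u → ρ (List.map -_ P) u ≈ - ρ P u
    ρ-map-neg []      u = sym -0#≈0#
    ρ-map-neg (a ∷ P) u = trans (+-congˡ (trans (φ-cong (ρ-map-neg P u)) (φ-neg _)))
      (solve 3 (λ a u x → (:- a) :* u :+ (:- x) := :- (a :* u :+ x)) refl a u _)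

    ρ-map-scale : ∀ {s} P u → F s → ρ (List.map (s *_) P) u ≈ s * ρ P u
    ρ-map-scale {s} []      u Fs = sym (zeroʳ s)
    ρ-map-scale {s} (a ∷ P) u Fs =
      trans (+-cong (*-assoc s a u) (trans (φ-cong (ρ-map-scale P u Fs)) (φ-scale _ Fs))) (sym (distribˡ s _ _))

    ρ-zeros : ∀ P u → All (_≈ 0#) P → ρ P u ≈ 0#
    ρ-zeros []      u []           = refl
    ρ-zeros (a ∷ P) u (a≈0 ∷ P≈0) =
      trans (+-cong (trans (*-congʳ a≈0) (zeroˡ u)) (trans (φ-cong (ρ-zeros P u P≈0)) φ-0)) (+-identityʳ _)

    ρ-[_] : ∀ a u → ρ [ a ] u ≈ a * u
    ρ-[ a ] u = trans (+-congˡ φ-0) (+-identityʳ _)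

    ρ-*ₚ : ∀ P Q u → Poly F P → ρ (P *ₚ Q) u ≈ ρ P (ρ Q u)
    ρ-*ₚ []      Q u []        = refl
    ρ-*ₚ (a ∷ P) Q u (Fa ∷ FP) = begin
      ρ (List.map (a *_) Q +ₚ (0# ∷ (P *ₚ Q))) u
        ≈⟨ ρ-+ₚ (List.map (a *_) Q) (0# ∷ (P *ₚ Q)) u ⟩
      ρ (List.map (a *_) Q) u + (0# * u + φ (ρ (P *ₚ Q) u))
        ≈⟨ +-cong (ρ-map-scale Q u Fa) (trans (+-congʳ (zeroˡ u)) (+-identityˡ _)) ⟩
      a * ρ Q u + φ (ρ (P *ₚ Q) u)
        ≈⟨ +-congˡ (φ-cong (ρ-*ₚ P Q u FP)) ⟩
      a * ρ Q u + φ (ρ P (ρ Q u))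
        ∎

    ρ-closed : ∀ {ℓs} {S : Pred Carrier ℓs} → IsSubfield S → F ⊆ S → S T →
               ∀ {P u} → Poly F P → S u → S (ρ P u)
    ρ-closed {S = S} S-subfield F⊆S ST = closed
      where
        module S = IsSubfield S-subfield
        closed : ∀ {P u} → Poly F P → S u → S (ρ P u)
        closed []        Su = S.has0
        closed (Fa ∷ FP) Su =
          S.+-cl (S.*-cl (F⊆S Fa) Su) (S.+-cl (^-closed S-subfield q (closed FP Su)) (S.*-cl ST (closed FP Su)))

    ρ-resp-≈ₚ : ∀ P Q u → P ≈ₚ Q → ρ P u ≈ ρ Q u
    ρ-resp-≈ₚ P Q u P≈Q = x∙y⁻¹≈ε⇒x≈y _ _ (begin
      ρ P u + - ρ Q u                  ≈⟨ +-congˡ (ρ-map-neg Q u) ⟨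
      ρ P u + ρ (List.map -_ Q) u      ≈⟨ ρ-+ₚ P (List.map -_ Q) u ⟨
      ρ (P +ₚ List.map -_ Q) u         ≈⟨ ρ-zeros _ u P≈Q ⟩
      0#                               ∎)

  -- The algorithm works with the values ⟦ P ⟧ = P(T); as T is transcendental over F, identities
  -- between values are turned back into identities of coefficient lists by eval-injective.
  module Euclid {ℓp} {F : Pred Carrier ℓp} (F-subfield : IsSubfield F)
                (≈0? : ∀ {x} → F x → Dec (x ≈ 0#)) (T : Carrier) where

    open IsSubfield F-subfield
    open PolynomialsOver F-subfield

    ⟦_⟧ : List Carrier → Carrier
    ⟦ P ⟧ = eval P T

    PolyValue : Pred Carrier (c ⊔ ℓ ⊔ ℓp)
    PolyValue x = ∃ λ P → Poly F P ∧ ⟦ P ⟧ ≈ x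

    PolyValue-const : ∀ {s} → F s → PolyValue s
    PolyValue-const {s} Fs = [ s ] , Fs ∷ [] , eval-[ s ] T

    PolyValue-T : PolyValue T
    PolyValue-T = 0# ∷ [ 1# ] , has0 ∷ has1 ∷ [] ,
      trans (+-identityˡ _) (trans (*-congˡ (eval-[ 1# ] T)) (*-identityʳ T))

    PolyValue-+ : ∀ {x y} → PolyValue x → PolyValue y → PolyValue (x + y)
    PolyValue-+ (P , FP , P≈x) (Q , FQ , Q≈y) = P +ₚ Q , Poly-+ₚ FP FQ , trans (eval-+ₚ P Q T) (+-cong P≈x Q≈y)

    PolyValue-neg : ∀ {x} → PolyValue x → PolyValue (- x)
    PolyValue-neg (P , FP , P≈x) = List.map -_ P , Poly-map-neg FP , trans (eval-map-neg P T) (-‿cong P≈x)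

    PolyValue-* : ∀ {x y} → PolyValue x → PolyValue y → PolyValue (x * y)
    PolyValue-* (P , FP , P≈x) (Q , FQ , Q≈y) = P *ₚ Q , Poly-*ₚ FP FQ , trans (eval-*ₚ P Q T) (*-cong P≈x Q≈y)

    PolyValue-^ : ∀ {x} n → PolyValue x → PolyValue (x ^ n)
    PolyValue-^ zero    _  = PolyValue-const has1
    PolyValue-^ (suc n) Vx = PolyValue-* Vx (PolyValue-^ n Vx)

    infix 4 _∈⟨_,_⟩
    _∈⟨_,_⟩ : Carrier → Carrier → Carrier → Set (c ⊔ ℓ ⊔ ℓp)
    x ∈⟨ a , b ⟩ = ∃₂ λ u v → PolyValue u ∧ PolyValue v ∧ x ≈ u * a + v * b

    left∈⟨_,_⟩ : ∀ a b → a ∈⟨ a , b ⟩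
    left∈⟨ a , b ⟩ = 1# , 0# , PolyValue-const has1 , PolyValue-const has0 ,
      sym (trans (+-cong (*-identityˡ a) (zeroˡ b)) (+-identityʳ a))

    ∈⟨⟩-swap : ∀ {x a b} → x ∈⟨ a , b ⟩ → x ∈⟨ b , a ⟩
    ∈⟨⟩-swap (u , v , Vu , Vv , x≈ua+vb) = v , u , Vv , Vu , trans x≈ua+vb (+-comm _ _)

    right∈⟨_,_⟩ : ∀ a b → b ∈⟨ a , b ⟩
    right∈⟨ a , b ⟩ = ∈⟨⟩-swap left∈⟨ b , a ⟩

    ∈⟨⟩-reduce-generator : ∀ {x a b r s} → PolyValue s → a ≈ r + s * b → x ∈⟨ a , b ⟩ → x ∈⟨ r , b ⟩
    ∈⟨⟩-reduce-generator {x} {a} {b} {r} {s} Vs a≈r+sb (u , v , Vu , Vv , x≈ua+vb) =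
      u , u * s + v , Vu , PolyValue-+ (PolyValue-* Vu Vs) Vv , (begin
        x                        ≈⟨ x≈ua+vb ⟩
        u * a + v * b            ≈⟨ +-congʳ (*-congˡ a≈r+sb) ⟩
        u * (r + s * b) + v * b
          ≈⟨ solve 5 (λ u v r s b → u :* (r :+ s :* b) :+ v :* b := u :* r :+ (u :* s :+ v) :* b) refl u v r s b ⟩
        u * r + (u * s + v) * b  ∎)

    ∈⟨⟩-sub-multiple : ∀ {x y a b} s → PolyValue s →
                       x ∈⟨ a , b ⟩ → y ∈⟨ a , b ⟩ → x + - (s * y) ∈⟨ a , b ⟩
    ∈⟨⟩-sub-multiple {x} {y} {a} {b} s Vs (u , v , Vu , Vv , x≈) (u′ , v′ , Vu′ , Vv′ , y≈) =
      u + - (s * u′) , v + - (s * v′) ,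
      PolyValue-+ Vu (PolyValue-neg (PolyValue-* Vs Vu′)) , PolyValue-+ Vv (PolyValue-neg (PolyValue-* Vs Vv′)) , (begin
        x + - (s * y)                                ≈⟨ +-cong x≈ (-‿cong (*-congˡ y≈)) ⟩
        (u * a + v * b) + - (s * (u′ * a + v′ * b))  ≈⟨ solve 7 (λ u v u′ v′ s a b →
                                                         (u :* a :+ v :* b) :+ :- (s :* (u′ :* a :+ v′ :* b))
                                                      := (u :+ :- (s :* u′)) :* a :+ (v :+ :- (s :* v′)) :* b) refl u v u′ v′ s a b ⟩
        (u + - (s * u′)) * a + (v + - (s * v′)) * b  ∎)

    ∈⟨⟩-resp : ∀ {x y a b} → x ≈ y → x ∈⟨ a , b ⟩ → y ∈⟨ a , b ⟩
    ∈⟨⟩-resp x≈y (u , v , Vu , Vv , x≈) = u , v , Vu , Vv , trans (sym x≈y) x≈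

    record SameIdeal (x y a b : Carrier) : Set (c ⊔ ℓ ⊔ ℓp) where
      field
        x∈⟨a,b⟩ : x ∈⟨ a , b ⟩
        y∈⟨a,b⟩ : y ∈⟨ a , b ⟩
        a∈⟨x,y⟩ : a ∈⟨ x , y ⟩
        b∈⟨x,y⟩ : b ∈⟨ x , y ⟩

    SameIdeal-refl : ∀ a b → SameIdeal a b a b
    SameIdeal-refl a b = record
      { x∈⟨a,b⟩ = left∈⟨ a , b ⟩ ; y∈⟨a,b⟩ = right∈⟨ a , b ⟩
      ; a∈⟨x,y⟩ = left∈⟨ a , b ⟩ ; b∈⟨x,y⟩ = right∈⟨ a , b ⟩ }

    SameIdeal-swap : ∀ {x y a b} → SameIdeal x y a b → SameIdeal y x a b
    SameIdeal-swap I = record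
      { x∈⟨a,b⟩ = y∈⟨a,b⟩ ; y∈⟨a,b⟩ = x∈⟨a,b⟩
      ; a∈⟨x,y⟩ = ∈⟨⟩-swap a∈⟨x,y⟩ ; b∈⟨x,y⟩ = ∈⟨⟩-swap b∈⟨x,y⟩ }
      where open SameIdeal I

    SameIdeal-reduce : ∀ {x y r s a b} → PolyValue s → x ≈ r + s * y → SameIdeal x y a b → SameIdeal r y a b
    SameIdeal-reduce {x} {y} {r} {s} Vs x≈r+sy I = record
      { x∈⟨a,b⟩ = ∈⟨⟩-resp r≈x-sy (∈⟨⟩-sub-multiple s Vs x∈⟨a,b⟩ y∈⟨a,b⟩)
      ; y∈⟨a,b⟩ = y∈⟨a,b⟩
      ; a∈⟨x,y⟩ = ∈⟨⟩-reduce-generator Vs x≈r+sy a∈⟨x,y⟩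
      ; b∈⟨x,y⟩ = ∈⟨⟩-reduce-generator Vs x≈r+sy b∈⟨x,y⟩
      }
      where
        open SameIdeal I
        r≈x-sy : x + - (s * y) ≈ r
        r≈x-sy = begin
          x + - (s * y)              ≈⟨ +-congʳ x≈r+sy ⟩
          (r + s * y) + - (s * y)    ≈⟨ solve 2 (λ r t → (r :+ t) :+ :- t := r) refl r (s * y) ⟩
          r                          ∎

    record Leading (P : List Carrier) : Set (c ⊔ ℓ ⊔ ℓp) where
      field
        body       : List Carrier
        coeff      : Carrier
        body-poly  : Poly F body
        coeff∈F    : F coeff
        coeff≉0    : ¬ (coeff ≈ 0#)
        split      : ⟦ P ⟧ ≈ ⟦ body ⟧ + T ^ length body * coeff
        shorter    : length body < length P

    vanishes-or-leading : ∀ {P} → Poly F P → ⟦ P ⟧ ≈ 0# ⊎ Leading P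
    vanishes-or-leading {[]}    []        = inj₁ refl
    vanishes-or-leading {a ∷ P} (Fa ∷ FP) with vanishes-or-leading FP
    ... | inj₂ lead = inj₂ (record
      { body = a ∷ body ; coeff = coeff ; body-poly = Fa ∷ body-poly ; coeff∈F = coeff∈F ; coeff≉0 = coeff≉0
      ; split = begin
          a + T * ⟦ P ⟧                                    ≈⟨ +-congˡ (*-congˡ split) ⟩
          a + T * (⟦ body ⟧ + T ^ length body * coeff)
            ≈⟨ solve 5 (λ a t p s b → a :+ t :* (p :+ s :* b) := (a :+ t :* p) :+ (t :* s) :* b)
                       refl a T ⟦ body ⟧ (T ^ length body) coeff ⟩
          (a + T * ⟦ body ⟧) + (T * T ^ length body) * coeff ∎
      ; shorter = ℕ.s≤s shorter })
      where open Leading lead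
    ... | inj₁ P≈0 with ≈0? Fa
    ...   | yes a≈0 = inj₁ (begin
      a + T * ⟦ P ⟧    ≈⟨ +-cong a≈0 (*-congˡ P≈0) ⟩
      0# + T * 0#     ≈⟨ solve 1 (λ t → con (ℤ.+ 0) :+ t :* con (ℤ.+ 0) := con (ℤ.+ 0)) refl T ⟩
      0#              ∎)
    ...   | no a≉0  = inj₂ (record
      { body = [] ; coeff = a ; body-poly = [] ; coeff∈F = Fa ; coeff≉0 = a≉0
      ; split = begin
          a + T * ⟦ P ⟧    ≈⟨ +-congˡ (*-congˡ P≈0) ⟩
          a + T * 0#      ≈⟨ trans (+-congˡ (zeroʳ T)) (+-identityʳ a) ⟩
          a               ≈⟨ trans (+-identityˡ _) (*-identityˡ a) ⟨
          0# + 1# * a     ∎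
      ; shorter = ℕ.s≤s ℕ.z≤n })

    record DivisionStep (P Q : List Carrier) : Set (c ⊔ ℓ ⊔ ℓp) where
      field
        remainder         : List Carrier
        remainder-poly    : Poly F remainder
        remainder-shorter : length remainder < length P
        quotient          : Carrier
        quotient-value    : PolyValue quotient
        division          : ⟦ P ⟧ ≈ ⟦ remainder ⟧ + quotient * ⟦ Q ⟧

    length-+ₚ : ∀ P Q → length (P +ₚ Q) ≡ length P ℕ.⊔ length Q
    length-+ₚ []      Q       = ≡.refl
    length-+ₚ (a ∷ P) []      = ≡.refl
    length-+ₚ (a ∷ P) (b ∷ Q) = ≡.cong suc (length-+ₚ P Q)

    divisionStep : ∀ {P Q} (lP : Leading P) (lQ : Leading Q) →
                   length (Leading.body lQ) ≤ length (Leading.body lP) → DivisionStep P Q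
    divisionStep {P} {Q} lP lQ n≤m = record
      { remainder         = R
      ; remainder-poly    = R-poly
      ; remainder-shorter = ℕ.≤-<-trans (ℕ.≤-reflexive length-R) P₀-shorter
      ; quotient          = s₀ * T ^ k
      ; quotient-value    = PolyValue-* (PolyValue-const s₀∈F) (PolyValue-^ k PolyValue-T)
      ; division          = division
      }
      where
        open Leading lP using () renaming
          (body to P₀; coeff to a; body-poly to P₀-poly; coeff∈F to a∈F; split to P-split; shorter to P₀-shorter)
        open Leading lQ using () renaming
          (body to Q₀; coeff to b; body-poly to Q₀-poly; coeff∈F to b∈F; coeff≉0 to b≉0; split to Q-split)
        m n k : ℕ
        m = length P₀
        n = length Q₀
        k = m ℕ.∸ n
        w : Carrier
        w = proj₁ (inverse b b≉0)
        bw≈1 : b * w ≈ 1#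
        bw≈1 = proj₂ (inverse b b≉0)
        s₀ : Carrier
        s₀ = a * w
        s₀∈F : F s₀
        s₀∈F = *-cl a∈F (inv-cl b∈F bw≈1)
        s₀b≈a : s₀ * b ≈ a
        s₀b≈a = trans (*-assoc a w b) (trans (*-congˡ (trans (*-comm w b) bw≈1)) (*-identityʳ a))
        Y R : List Carrier
        Y = List.replicate k 0# List.++ List.map (s₀ *_) Q₀
        R = P₀ +ₚ List.map -_ Y
        R-poly : Poly F R
        R-poly = Poly-+ₚ P₀-poly (Poly-map-neg (Poly-shift k (Poly-map-scale s₀∈F Q₀-poly)))
        k+n≡m : k ℕ.+ n ≡ m
        k+n≡m = ℕ.m∸n+n≡m n≤m
        length-R : length R ≡ m
        length-R = ≡.trans (length-+ₚ P₀ (List.map -_ Y)) (≡.trans (≡.cong (m ℕ.⊔_) length-Y) (ℕ.⊔-idem m))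
          where
            length-Y : length (List.map -_ Y) ≡ m
            length-Y = ≡.trans (List.length-map -_ Y) (≡.trans (List.length-++ (List.replicate k 0#))
                         (≡.trans (≡.cong₂ ℕ._+_ (List.length-replicate k) (List.length-map (s₀ *_) Q₀)) k+n≡m))
        ⟦R⟧ : ⟦ R ⟧ ≈ ⟦ P₀ ⟧ + - (T ^ k * (s₀ * ⟦ Q₀ ⟧))
        ⟦R⟧ = trans (eval-+ₚ P₀ (List.map -_ Y) T) (+-congˡ (trans (eval-map-neg Y T)
                (-‿cong (trans (eval-shift k (List.map (s₀ *_) Q₀) T) (*-congˡ (eval-map-scale s₀ Q₀ T))))))
        division : ⟦ P ⟧ ≈ ⟦ R ⟧ + (s₀ * T ^ k) * ⟦ Q ⟧
        division = begin
          ⟦ P ⟧                                                 ≈⟨ P-split ⟩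
          ⟦ P₀ ⟧ + T ^ m * a
            ≈⟨ +-congˡ (*-cong (trans (reflexive (≡.cong (T ^_) (≡.sym k+n≡m))) (^-homo-* T k n)) (sym s₀b≈a)) ⟩
          ⟦ P₀ ⟧ + (T ^ k * T ^ n) * (s₀ * b)
            ≈⟨ solve 6 (λ p q s tk tn b → p :+ (tk :* tn) :* (s :* b)
                                       := (p :+ :- (tk :* (s :* q))) :+ (s :* tk) :* (q :+ tn :* b))
                       refl ⟦ P₀ ⟧ ⟦ Q₀ ⟧ s₀ (T ^ k) (T ^ n) b ⟩
          (⟦ P₀ ⟧ + - (T ^ k * (s₀ * ⟦ Q₀ ⟧))) + (s₀ * T ^ k) * (⟦ Q₀ ⟧ + T ^ n * b)
            ≈⟨ +-cong (sym ⟦R⟧) (*-congˡ (sym Q-split)) ⟩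
          ⟦ R ⟧ + (s₀ * T ^ k) * ⟦ Q ⟧                            ∎

    infix 4 _∣ᵛ_
    _∣ᵛ_ : Carrier → Carrier → Set (c ⊔ ℓ ⊔ ℓp)
    d ∣ᵛ x = ∃ λ u → PolyValue u ∧ x ≈ u * d

    record Gcd (M N : List Carrier) : Set (c ⊔ ℓ ⊔ ℓp) where
      field
        gcd       : List Carrier
        gcd-poly  : Poly F gcd
        gcd∈⟨M,N⟩ : ⟦ gcd ⟧ ∈⟨ ⟦ M ⟧ , ⟦ N ⟧ ⟩
        gcd∣M     : ⟦ gcd ⟧ ∣ᵛ ⟦ M ⟧
        gcd∣N     : ⟦ gcd ⟧ ∣ᵛ ⟦ N ⟧

    module _ {M N : List Carrier} where

      gcd-of-vanishing : ∀ {P Q} → Poly F P → ⟦ Q ⟧ ≈ 0# → SameIdeal ⟦ P ⟧ ⟦ Q ⟧ ⟦ M ⟧ ⟦ N ⟧ → Gcd M N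
      gcd-of-vanishing {P} {Q} FP Q≈0 I = record
        { gcd = P ; gcd-poly = FP ; gcd∈⟨M,N⟩ = x∈⟨a,b⟩
        ; gcd∣M = ∈⟨P,0⟩⇒∣ᵛ a∈⟨x,y⟩ ; gcd∣N = ∈⟨P,0⟩⇒∣ᵛ b∈⟨x,y⟩ }
        where
          open SameIdeal I
          ∈⟨P,0⟩⇒∣ᵛ : ∀ {z} → z ∈⟨ ⟦ P ⟧ , ⟦ Q ⟧ ⟩ → ⟦ P ⟧ ∣ᵛ z
          ∈⟨P,0⟩⇒∣ᵛ (u , v , Vu , _ , z≈) =
            u , Vu , trans z≈ (trans (+-congˡ (trans (*-congˡ Q≈0) (zeroʳ v))) (+-identityʳ _))

      euclid : ∀ fuel {P Q} → Poly F P → Poly F Q → length P ℕ.+ length Q < fuel →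
               SameIdeal ⟦ P ⟧ ⟦ Q ⟧ ⟦ M ⟧ ⟦ N ⟧ → Gcd M N
      euclid (suc fuel) {P} {Q} FP FQ bound I with vanishes-or-leading FP | vanishes-or-leading FQ
      ... | _        | inj₁ Q≈0 = gcd-of-vanishing {Q = Q} FP Q≈0 I
      ... | inj₁ P≈0 | inj₂ _   = gcd-of-vanishing {Q = P} FQ P≈0 (SameIdeal-swap I)
      ... | inj₂ lP  | inj₂ lQ  with length (Leading.body lQ) ℕ.≤? length (Leading.body lP)
      ...   | yes Q₀≤P₀ = euclid fuel remainder-poly FQ
                            (ℕ.<-≤-trans (ℕ.+-monoˡ-< (length Q) remainder-shorter) (ℕ.≤-pred bound))
                            (SameIdeal-reduce quotient-value division I)
        where open DivisionStep (divisionStep lP lQ Q₀≤P₀)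
      ...   | no  Q₀≰P₀ = euclid fuel FP remainder-poly
                            (ℕ.<-≤-trans (ℕ.+-monoʳ-< (length P) remainder-shorter) (ℕ.≤-pred bound))
                            (SameIdeal-swap (SameIdeal-reduce quotient-value division (SameIdeal-swap I)))
        where open DivisionStep (divisionStep lQ lP (ℕ.<⇒≤ (ℕ.≰⇒> Q₀≰P₀)))

    gcdOf : ∀ {M N} → Poly F M → Poly F N → Gcd M N
    gcdOf {M} {N} FM FN = euclid (suc (length M ℕ.+ length N)) FM FN ℕ.≤-refl (SameIdeal-refl ⟦ M ⟧ ⟦ N ⟧)

    module _ (transcendental : ∀ P → Poly F P → ⟦ P ⟧ ≈ 0# → All (_≈ 0#) P) where

      eval-injective : ∀ {P Q} → Poly F P → Poly F Q → ⟦ P ⟧ ≈ ⟦ Q ⟧ → P ≈ₚ Q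
      eval-injective {P} {Q} FP FQ P≈Q = transcendental _ (Poly-+ₚ FP (Poly-map-neg FQ)) (begin
        ⟦ P +ₚ List.map -_ Q ⟧         ≈⟨ eval-+ₚ P (List.map -_ Q) T ⟩
        ⟦ P ⟧ + ⟦ List.map -_ Q ⟧      ≈⟨ +-cong P≈Q (eval-map-neg Q T) ⟩
        ⟦ Q ⟧ + - ⟦ Q ⟧                ≈⟨ -‿inverseʳ _ ⟩
        0#                             ∎)

      record BezoutIdentity (M N : List Carrier) : Set (c ⊔ ℓ ⊔ ℓp) where
        field
          unit     : Carrier
          unit∈F   : F unit
          unit≉0   : ¬ (unit ≈ 0#)
          A B      : List Carrier
          A-poly   : Poly F A
          B-poly   : Poly F B
          identity : ((A *ₚ M) +ₚ (B *ₚ N)) ≈ₚ [ unit ]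

      ∣ᵛ⇒Divides : ∀ {D P} → Poly F D → Poly F P → ⟦ D ⟧ ∣ᵛ ⟦ P ⟧ → Divides F D P
      ∣ᵛ⇒Divides {D} {P} FD FP (u , (Q , FQ , ⟦Q⟧≈u) , P≈uD) = Q , FQ , eval-injective (Poly-*ₚ FD FQ) FP (begin
        ⟦ D *ₚ Q ⟧        ≈⟨ eval-*ₚ D Q T ⟩
        ⟦ D ⟧ * ⟦ Q ⟧     ≈⟨ *-congˡ ⟦Q⟧≈u ⟩
        ⟦ D ⟧ * u         ≈⟨ *-comm _ _ ⟩
        u * ⟦ D ⟧         ≈⟨ P≈uD ⟨
        ⟦ P ⟧             ∎)

      bezout : ∀ {M N} → Poly F M → Poly F N → RelPrime F M N → BezoutIdentity M N
      bezout {M} {N} FM FN M⊥N with gcdOf FM FN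
      ... | record { gcd = D ; gcd-poly = FD ; gcd∣M = D∣M ; gcd∣N = D∣N
                   ; gcd∈⟨M,N⟩ = x , y , (A , A-poly , ⟦A⟧≈x) , (B , B-poly , ⟦B⟧≈y) , D≈xM+yN }
          with M⊥N D FD (∣ᵛ⇒Divides FD FM D∣M) (∣ᵛ⇒Divides FD FN D∣N)
      ... | u , u∈F , u≉0 , D≈u = record
        { unit = u ; unit∈F = u∈F ; unit≉0 = u≉0 ; A = A ; B = B ; A-poly = A-poly ; B-poly = B-poly
        ; identity = eval-injective (Poly-+ₚ (Poly-*ₚ A-poly FM) (Poly-*ₚ B-poly FN)) (u∈F ∷ []) (begin
            ⟦ (A *ₚ M) +ₚ (B *ₚ N) ⟧           ≈⟨ eval-+ₚ (A *ₚ M) (B *ₚ N) T ⟩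
            ⟦ A *ₚ M ⟧ + ⟦ B *ₚ N ⟧         ≈⟨ +-cong (eval-*ₚ A M T) (eval-*ₚ B N T) ⟩
            ⟦ A ⟧ * ⟦ M ⟧ + ⟦ B ⟧ * ⟦ N ⟧   ≈⟨ +-cong (*-congʳ ⟦A⟧≈x) (*-congʳ ⟦B⟧≈y) ⟩
            x * ⟦ M ⟧ + y * ⟦ N ⟧           ≈⟨ D≈xM+yN ⟨
            ⟦ D ⟧                           ≈⟨ eval-≈ₚ D [ u ] T D≈u ⟩
            ⟦ [ u ] ⟧                       ∎) }

  module CoprimeSummands {ℓp} {q : ℕ} (q-primePower : IsPrimePower q)
                         {F : Pred Carrier ℓp} {T : Carrier} (closure : IsAlgClosureOfFqT q F T)
    where

    open IsAlgClosureOfFqT closure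
    open FiniteSubfield F-subfield enum enum-in enum-inj enum-surj
    open CarlitzAction q F-subfield T (x+y^q≈x^q+y^q q-primePower) x^q≈x
    open Euclid F-subfield ≈0? T

    summand∈ : ∀ {ℓs} {S : Pred Carrier ℓs} → IsSubfield S → F ⊆ S → S T →
               ∀ {M N α β} → Poly F M → Poly F N → RelPrime F M N →
               S (α + β) → S (ρ M α) → S (ρ N β) → S α
    summand∈ {S = S} S-subfield F⊆S ST {M} {N} {α} {β} FM FN M⊥N Sα+β Sαᴹ Sβᴺ =
      S.resp (inverse-cancelˡ α uw≈1) (S.*-cl (S.inv-cl (F⊆S unit∈F) uw≈1) Suα)
      where
        module S = IsSubfield S-subfield
        open BezoutIdentity (bezout transcendental FM FN M⊥N)
        w : Carrier
        w = proj₁ (inverse unit unit≉0)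
        uw≈1 : unit * w ≈ 1#
        uw≈1 = proj₂ (inverse unit unit≉0)
        ρ-closedS : ∀ {P u} → Poly F P → S u → S (ρ P u)
        ρ-closedS = ρ-closed S-subfield F⊆S ST
        αᴺ≈ : ρ N α ≈ ρ N (α + β) + - ρ N β
        αᴺ≈ = begin
          ρ N α                       ≈⟨ ρ-congʳ N (solve 2 (λ a b → a := (a :+ b) :+ :- b) refl α β) ⟩
          ρ N ((α + β) + - β)         ≈⟨ ρ-+ʳ N (α + β) (- β) ⟩
          ρ N (α + β) + ρ N (- β)     ≈⟨ +-congˡ (ρ-negʳ N β) ⟩
          ρ N (α + β) + - ρ N β       ∎
        uα≈ : unit * α ≈ ρ A (ρ M α) + ρ B (ρ N α)
        uα≈ = begin
          unit * α                          ≈⟨ ρ-[ unit ] α ⟨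
          ρ [ unit ] α                      ≈⟨ ρ-resp-≈ₚ ((A *ₚ M) +ₚ (B *ₚ N)) [ unit ] α identity ⟨
          ρ ((A *ₚ M) +ₚ (B *ₚ N)) α         ≈⟨ ρ-+ₚ (A *ₚ M) (B *ₚ N) α ⟩
          ρ (A *ₚ M) α + ρ (B *ₚ N) α        ≈⟨ +-cong (ρ-*ₚ A M α A-poly) (ρ-*ₚ B N α B-poly) ⟩
          ρ A (ρ M α) + ρ B (ρ N α)          ∎
        Sαᴺ : S (ρ N α)
        Sαᴺ = S.resp (sym αᴺ≈) (S.+-cl (ρ-closedS FN Sα+β) (S.neg-cl Sβᴺ))
        Suα : S (unit * α)
        Suα = S.resp (sym uα≈) (S.+-cl (ρ-closedS A-poly Sαᴹ) (ρ-closedS B-poly Sαᴺ))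

    K⟨α,β⟩≐K⟨α+β⟩ : ∀ {ℓk} {K : Pred Carrier ℓk} → Gen (λ y → F y ⊎ y ≈ T) ⊆ K →
                    ∀ {M N α β a b} → Poly F M → Poly F N → RelPrime F M N → K a → K b →
                    ρ M α ≈ a → ρ N β ≈ b → Adj₂ K α β ≐ Adj₁ K (α + β)
    K⟨α,β⟩≐K⟨α+β⟩ {K = K} k⊆K {α = α} {β} FM FN M⊥N Ka Kb αᴹ≈a βᴺ≈b =
      Adj₂≐Adj₁ α∈K⟨γ⟩ β∈K⟨γ⟩ γ∈K⟨α,β⟩
      where
        K⊆K⟨γ⟩ : K ⊆ Adj₁ K (α + β)
        K⊆K⟨γ⟩ Ky = base (inj₁ Ky)
        γ∈K⟨γ⟩ : Adj₁ K (α + β) (α + β)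
        γ∈K⟨γ⟩ = base (inj₂ refl)
        γ∈K⟨α,β⟩ : Adj₂ K α β (α + β)
        γ∈K⟨α,β⟩ = add (base (inj₂ (inj₁ refl))) (base (inj₂ (inj₂ refl)))
        α∈K⟨γ⟩ : Adj₁ K (α + β) α
        α∈K⟨γ⟩ = summand∈ Gen-isSubfield (λ Fy → K⊆K⟨γ⟩ (k⊆K (base (inj₁ Fy)))) (K⊆K⟨γ⟩ (k⊆K (base (inj₂ refl))))
                   FM FN M⊥N γ∈K⟨γ⟩ (resp (sym αᴹ≈a) (K⊆K⟨γ⟩ Ka)) (resp (sym βᴺ≈b) (K⊆K⟨γ⟩ Kb))
        β∈K⟨γ⟩ : Adj₁ K (α + β) β
        β∈K⟨γ⟩ = resp (solve 2 (λ a b → (a :+ b) :+ :- a := b) refl α β) (add γ∈K⟨γ⟩ (neg α∈K⟨γ⟩))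

mainTheorem12 : ∀ {c ℓ ℓp ℓk ℓl} (Ω : Field c ℓ) → let open Field Ω in let open FieldDefs Ω in
    (q : ℕ) → IsPrimePower q →
    (F : Pred Carrier ℓp) (T : Carrier) → IsAlgClosureOfFqT q F T →
    (K : Pred Carrier ℓk) (L : Pred Carrier ℓl) →
    IsSubfield K → IsSubfield L →
    Gen (λ y → F y ⊎ y ≈ T) ⊆ K → K ⊆ L →
    (α β : Carrier) → L ≐ Adj₂ K α β →
    (M N : List Carrier) → Poly F M → Poly F N → RelPrime F M N →
    (a b : Carrier) → K a → K b →
    carlitz q T M α ≈ a → carlitz q T N β ≈ b →
    L ≐ Adj₁ K (α + β)
mainTheorem12 Ω q q-primePower F T closure K _ _ _ k⊆K _ α β L≐K⟨α,β⟩ _ _ FM FN M⊥N _ _ Ka Kb αᴹ≈a βᴺ≈b x =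
  ⇔.trans (L≐K⟨α,β⟩ x) (K⟨α,β⟩≐K⟨α+β⟩ k⊆K FM FN M⊥N Ka Kb αᴹ≈a βᴺ≈b x)
  where open FieldTheory.CoprimeSummands Ω q-primePower closure
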